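{- Let $f:\{0,1\}^n\to\{0,1\}^n$ be a Boolean network whose interaction graph $G(f)$ has no positive cycles, let $F$ be a feedback vertex set of $G(f)$, let $\pi=(\pi_1,\dots,\pi_n)$ be a permutation of $[n]$ such that (i) every vertex of $F$ appears in $\pi$ after every vertex not in $F$, and (ii) for all $\pi_i,\pi_j\notin F$, if $(\pi_i,\pi_j)$ is an arc of $G(f)$ then $i<j$; and let $y\in\{0,1\}^n$. Then $y$ is the unique fixed point of $f$ if and only if $(f^{\pi})^{\langle |F|+1\rangle}(x)=y$ for all $x\in\{0,1\}^n$.
   Context: A Boolean network with $n$ components is a map $f=(f_1,\dots,f_n):\{0,1\}^n\to\{0,1\}^n$; a fixed point is $x$ with $f(x)=x$. With $e_u$ the $u$-th unit vector, the interaction graph $G(f)$ is the signed digraph on $[n]$ with a positive arc $(u,v)$ if some $x$ with $x_u=0$ has $f_v(x)<f_v(x+e_u)$, and a negative arc $(u,v)$ if some $x$ with $x_u=0$ has $f_v(x)>f_v(x+e_u)$. A cycle is positive if the product of its arc signs is $+1$. A feedback vertex set (FVS) of $G(f)$ is $F\subseteq[n]$ with $G(f)-F$ acyclic. For $u\in[n]$, $f^u(x)=(x_1,\dots,x_{u-1},f_u(x),x_{u+1},\dots,x_n)$; for a permutation $\pi$ of $[n]$, $f^{\pi}=f^{\pi_n}\circ\cdots\circ f^{\pi_1}$. $g^{\langle 0\rangle}$ is the identity and $g^{\langle k\rangle}=g\circ g^{\langle k-1\rangle}$. -}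

module Defs where

open import Data.Nat using (ℕ; zero; suc)
open import Data.Bool using (Bool; true; false)
open import Data.Fin using (Fin; zero; suc; inject₁; fromℕ; _<_)
open import Data.Fin.Subset using (Subset; _∈_; _∉_; ∣_∣)
open import Data.Fin.Permutation using (Permutation′; _⟨$⟩ʳ_)
open import Data.Vec using (Vec; lookup; _[_]≔_)
open import Data.List using (List; []; _∷_; tabulate)
open import Data.Product using (Σ; ∃; _×_; _,_)
open import Function.Definitions using (Injective)
open import Relation.Binary.PropositionalEquality using (_≡_)
open import Relation.Nullary using (¬_)

-- Configurations in {0,1}^n (false = 0, true = 1)
Config : ℕ → Set
Config n = Vec Bool n

BN : ℕ → Set
BN n = Config n → Config n

data Sign : Set where
  pos neg : Sign

_·_ : Sign → Sign → Sign
pos · s = s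
neg · pos = neg
neg · neg = pos

-- Positive / negative arcs of the interaction graph G(f)
-- (x + e_u with x_u = 0 is x with coordinate u set to 1)
PosArc : ∀ {n} → BN n → Fin n → Fin n → Set
PosArc f u v = ∃ λ x → lookup x u ≡ false
  × lookup (f x) v ≡ false × lookup (f (x [ u ]≔ true)) v ≡ true

NegArc : ∀ {n} → BN n → Fin n → Fin n → Set
NegArc f u v = ∃ λ x → lookup x u ≡ false
  × lookup (f x) v ≡ true × lookup (f (x [ u ]≔ true)) v ≡ false

Arc : ∀ {n} → BN n → Sign → Fin n → Fin n → Set
Arc f pos u v = PosArc f u v
Arc f neg u v = NegArc f u v

signProd : ∀ {k} → (Fin k → Sign) → Sign
signProd {zero} s = pos
signProd {suc k} s = s zero · signProd (λ i → s (suc i))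

-- A (simple, directed) cycle of G(f) of length k+1:
-- distinct vertices v_0,…,v_k with signed arcs v_i → v_{i+1} (i < k)
-- and a closing signed arc v_k → v_0.  The arc v_i → v_{i+1} has sign
-- sgn (inject₁ i), the closing arc has sign sgn (fromℕ k).
record Cycle {n} (f : BN n) : Set where
  field
    len   : ℕ
    vtx   : Fin (suc len) → Fin n
    inj   : Injective _≡_ _≡_ vtx
    sgn   : Fin (suc len) → Sign
    arcs  : ∀ (i : Fin len) → Arc f (sgn (inject₁ i)) (vtx (inject₁ i)) (vtx (suc i))
    close : Arc f (sgn (fromℕ len)) (vtx (fromℕ len)) (vtx zero)

  sign : Sign
  sign = signProd sgn

open Cycle public

NoPositiveCycle : ∀ {n} → BN n → Set
NoPositiveCycle f = ¬ (Σ (Cycle f) λ c → sign c ≡ pos)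

IsFVS : ∀ {n} → BN n → Subset n → Set
IsFVS f F = ¬ (Σ (Cycle f) λ c → ∀ i → vtx c i ∉ F)

update : ∀ {n} → BN n → Fin n → Config n → Config n
update f u x = x [ u ]≔ lookup (f x) u

updateSeq : ∀ {n} → BN n → List (Fin n) → Config n → Config n
updateSeq f [] x = x
updateSeq f (u ∷ us) x = updateSeq f us (update f u x)

-- f^π = f^{π_n} ∘ … ∘ f^{π_1}, where π_i = π ⟨$⟩ʳ i
seqUpdate : ∀ {n} → BN n → Permutation′ n → Config n → Config n
seqUpdate {n} f π = updateSeq f (tabulate {n = n} (π ⟨$⟩ʳ_))

iter : ∀ {A : Set} → (A → A) → ℕ → A → A
iter g zero x = x
iter g (suc k) x = g (iter g k x)

UniqueFixedPoint : ∀ {n} → BN n → Config n → Set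
UniqueFixedPoint f y = f y ≡ y × (∀ z → f z ≡ z → z ≡ y)

-- Let y be a fixed point of f and call an arc u → v of G(f) consistent when its
-- sign is positive exactly if y_u = y_v.  Along a consistent walk the signs
-- telescope, so a closed consistent walk is a positive cycle; hence simple
-- consistent paths never close up and pass through at most |F| vertices of F.
-- If an update sets x_v ≠ y_v = f(y)_v, some u with x_u ≠ y_u influences v along
-- a consistent arc.  The order π makes u either a vertex of F or a vertex already
-- updated in the current round, so by induction, after p rounds every component
-- disagreeing with y ends a simple consistent path through at least p vertices
-- of F; after |F| + 1 rounds none is left.  Conversely f and f^π have the same
-- fixed points, so if every orbit of f^π reaches y, then y is the only one.
module Submission where

open import Defs
open import Level using (0ℓ)
open import Function using (_∘_)
open import Function.Bundles using (_⇔_; mk⇔)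
open import Function.Definitions using (Injective)
open import Data.Nat using (ℕ; zero; suc; _+_; _≤_; z≤n; s<s⁻¹)
open import Data.Nat.Properties using (≤-trans; ≤-<-trans; +-assoc; +-comm; +-identityʳ; +-monoˡ-≤; m≤m+n; n≤1+n; 1+n≰n)
open import Data.Bool using (Bool; true; false; not; if_then_else_)
open import Data.Bool.Properties using (¬-not) renaming (_≟_ to _≟ᵇ_)
open import Data.Fin using (Fin; zero; suc; _<_; inject₁; fromℕ; _≟_)
open import Data.Fin.Subset using (Subset; _∈_; _∉_; ∣_∣; _-_)
open import Data.Fin.Subset.Properties using (_∈?_; x∈p∧x≢y⇒x∈p-y; x∈p⇒∣p-x∣<∣p∣)
open import Data.Fin.Permutation using (Permutation′; _⟨$⟩ʳ_; _⟨$⟩ˡ_; inverseʳ; inverseˡ)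
open import Data.Vec using ([]; _∷_; lookup; _[_]≔_)
open import Data.Vec.Properties using (lookup∘update; lookup∘update′; []≔-lookup)
open import Data.Vec.Relation.Binary.Pointwise.Extensional using (ext; Pointwise-≡⇒≡)
open import Data.List using (List; []; _∷_; tabulate)
open import Data.List.Membership.Propositional using () renaming (_∈_ to _∈ₗ_)
open import Data.List.Membership.Propositional.Properties using (∈-tabulate⁺)
open import Data.List.Relation.Unary.Any using (here; there)
open import Data.List.Relation.Unary.All using (All; []; _∷_)
open import Data.List.Relation.Unary.All.Properties using (tabulate⁻)
open import Data.List.Relation.Unary.Unique.Propositional using (Unique; []; _∷_)
open import Data.List.Relation.Unary.Unique.Propositional.Properties using (tabulate⁺)
open import Data.Product using (Σ; ∃; _×_; _,_; proj₁; proj₂)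
open import Data.Sum using (_⊎_; inj₁; inj₂; [_,_]; map₁)
open import Data.Empty using (⊥-elim)
open import Data.Unit using (⊤; tt)
open import Relation.Binary using (Rel)
open import Relation.Binary.Construct.Closure.ReflexiveTransitive using (Star; ε; _◅_; _◅◅_)
open import Relation.Binary.PropositionalEquality
  using (_≡_; _≢_; refl; sym; trans; cong; cong₂; subst; subst₂; module ≡-Reasoning)
open import Relation.Nullary using (¬_; Dec; yes; no; does; contradiction)
open import Relation.Nullary.Decidable using (_⊎-dec_; dec-true; decidable-stable)
open import Relation.Unary using (Pred; _⊆_; _∪_; ∅; ｛_｝)

signOf : Bool → Bool → Sign
signOf false false = pos
signOf true  true  = pos
signOf false true  = neg
signOf true  false = neg

signOf-refl : ∀ a → signOf a a ≡ pos
signOf-refl false = refl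
signOf-refl true  = refl

signOf-not : ∀ a b → signOf (not a) (not b) ≡ signOf a b
signOf-not false false = refl
signOf-not false true  = refl
signOf-not true  false = refl
signOf-not true  true  = refl

signOf-trans : ∀ a b c → signOf a b · signOf b c ≡ signOf a c
signOf-trans false false false = refl
signOf-trans false false true  = refl
signOf-trans false true  false = refl
signOf-trans false true  true  = refl
signOf-trans true  false false = refl
signOf-trans true  false true  = refl
signOf-trans true  true  false = refl
signOf-trans true  true  true  = refl

·-identityʳ : ∀ s → s · pos ≡ s
·-identityʳ pos = refl
·-identityʳ neg = refl

Influence : ∀ {n} → (Config n → Bool) → Sign → Fin n → Set
Influence φ pos u = ∃ λ x → lookup x u ≡ false × φ x ≡ false × φ (x [ u ]≔ true) ≡ true
Influence φ neg u = ∃ λ x → lookup x u ≡ false × φ x ≡ true × φ (x [ u ]≔ true) ≡ false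

Influence⇒Arc : ∀ {n} (f : BN n) s u v → Influence (λ x → lookup (f x) v) s u → Arc f s u v
Influence⇒Arc f pos u v influence = influence
Influence⇒Arc f neg u v influence = influence

Influence-∷ : ∀ {n} (φ : Config (suc n) → Bool) c s u →
              Influence (λ xs → φ (c ∷ xs)) s u → Influence φ s (suc u)
Influence-∷ φ c pos u (x , xu≡0 , φ₀ , φ₁) = c ∷ x , xu≡0 , φ₀ , φ₁
Influence-∷ φ c neg u (x , xu≡0 , φ₀ , φ₁) = c ∷ x , xu≡0 , φ₀ , φ₁

sensitive⇒influence : ∀ {n} (φ : Config n → Bool) x {u} → lookup x u ≡ false →
                      φ x ≢ φ (x [ u ]≔ true) → Influence φ (signOf false (φ x)) u
sensitive⇒influence φ x {u} xu≡0 sensitive with φ x in φ₀ | φ (x [ u ]≔ true) in φ₁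
... | false | true  = x , xu≡0 , φ₀ , φ₁
... | true  | false = x , xu≡0 , φ₀ , φ₁
... | false | false = contradiction refl sensitive
... | true  | true  = contradiction refl sensitive

head-influence : ∀ {n} (φ : Config (suc n) → Bool) b c xs → φ (b ∷ xs) ≢ φ (c ∷ xs) →
                 Influence φ (signOf b (φ (b ∷ xs))) zero
head-influence φ false true  xs sensitive = sensitive⇒influence φ (false ∷ xs) refl sensitive
head-influence φ true  false xs sensitive =
  subst (λ s → Influence φ s zero) sign-eq
        (sensitive⇒influence φ (false ∷ xs) refl (sensitive ∘ sym))
  where
  sign-eq : signOf false (φ (false ∷ xs)) ≡ signOf true (φ (true ∷ xs))
  sign-eq = trans (cong (signOf false) (¬-not (sensitive ∘ sym))) (signOf-not true _)
head-influence φ false false xs sensitive = contradiction refl sensitive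
head-influence φ true  true  xs sensitive = contradiction refl sensitive

difference⇒influence : ∀ {n} (φ : Config n → Bool) x z → φ x ≢ φ z →
                       ∃ λ u → lookup x u ≢ lookup z u × Influence φ (signOf (lookup x u) (φ x)) u
difference⇒influence φ [] [] φx≢φz = contradiction refl φx≢φz
difference⇒influence φ (b ∷ xs) (c ∷ zs) φx≢φz with φ (b ∷ xs) ≟ᵇ φ (c ∷ xs)
... | no head-differs =
  zero , head-differs ∘ cong (λ t → φ (t ∷ xs)) , head-influence φ b c xs head-differs
... | yes same with difference⇒influence (λ ws → φ (c ∷ ws)) xs zs (φx≢φz ∘ trans same)
...   | u , xu≢zu , influence =
  suc u , xu≢zu ,
  subst (λ t → Influence φ (signOf (lookup xs u) t) (suc u)) (sym same) (Influence-∷ φ c _ u influence)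

module ConsistentWalks {n} (f : BN n) (y : Config n) where

  σ : Fin n → Fin n → Sign
  σ u v = signOf (lookup y u) (lookup y v)

  Consistent : Rel (Fin n) 0ℓ
  Consistent u v = Arc f (σ u v) u v

  Walk : Rel (Fin n) 0ℓ
  Walk = Star Consistent

  wrong-update⇒consistent-culprit : f y ≡ y → ∀ x {v} → lookup (f x) v ≢ lookup y v →
                                    ∃ λ u → lookup x u ≢ lookup y u × Consistent u v
  wrong-update⇒consistent-culprit fy x {v} fxv≢yv
    with difference⇒influence (λ z → lookup (f z) v) x y
           (λ fxv≡fyv → fxv≢yv (trans fxv≡fyv (cong (λ z → lookup z v) fy)))
  ... | u , xu≢yu , influence =
    u , xu≢yu , subst (λ s → Arc f s u v) sign-eq (Influence⇒Arc f _ u v influence)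
    where
    sign-eq : signOf (lookup x u) (lookup (f x) v) ≡ σ u v
    sign-eq = trans (cong₂ signOf (¬-not xu≢yu) (¬-not fxv≢yv)) (signOf-not _ _)

  infix 4 _∈ᵥ_ _∈ᵥ?_

  _∈ᵥ_ : ∀ {a b} → Fin n → Walk a b → Set
  _∈ᵥ_ {a} w ε       = w ≡ a
  _∈ᵥ_ {a} w (_ ◅ q) = w ≡ a ⊎ w ∈ᵥ q

  _∈ᵥ?_ : ∀ {a b} w (q : Walk a b) → Dec (w ∈ᵥ q)
  _∈ᵥ?_ {a} w ε       = w ≟ a
  _∈ᵥ?_ {a} w (_ ◅ q) = w ≟ a ⊎-dec w ∈ᵥ? q

  Distinct : ∀ {a b} → Walk a b → Set
  Distinct ε             = ⊤
  Distinct (_◅_ {a} _ q) = ¬ a ∈ᵥ q × Distinct q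

  ∈ᵥ-snoc : ∀ {a u v w} (q : Walk a u) (e : Consistent u v) → w ∈ᵥ q ◅◅ e ◅ ε → w ∈ᵥ q ⊎ w ≡ v
  ∈ᵥ-snoc ε       e (inj₁ w≡u) = inj₁ w≡u
  ∈ᵥ-snoc ε       e (inj₂ w≡v) = inj₂ w≡v
  ∈ᵥ-snoc (_ ◅ q) e (inj₁ w≡a) = inj₁ (inj₁ w≡a)
  ∈ᵥ-snoc (_ ◅ q) e (inj₂ w∈)  = map₁ inj₂ (∈ᵥ-snoc q e w∈)

  distinct-snoc : ∀ {a u v} (q : Walk a u) (e : Consistent u v) →
                  Distinct q → ¬ v ∈ᵥ q → Distinct (q ◅◅ e ◅ ε)
  distinct-snoc ε       e _          v∉q = v∉q ∘ sym , tt
  distinct-snoc (_ ◅ q) e (a∉q , dq) v∉q =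
    [ a∉q , v∉q ∘ inj₁ ∘ sym ] ∘ ∈ᵥ-snoc q e , distinct-snoc q e dq (v∉q ∘ inj₂)

  suffix : ∀ {a b w} (q : Walk a b) → w ∈ᵥ q → Distinct q → Σ (Walk w b) Distinct
  suffix ε       refl         _        = ε , tt
  suffix (e ◅ q) (inj₁ refl)  dq       = e ◅ q , dq
  suffix (e ◅ q) (inj₂ w∈q)   (_ , dq) = suffix q w∈q dq

  steps : ∀ {a b} → Walk a b → ℕ
  steps ε       = 0
  steps (_ ◅ q) = suc (steps q)

  vertex : ∀ {a b} (q : Walk a b) → Fin (suc (steps q)) → Fin n
  vertex {a} q       zero    = a
  vertex     (_ ◅ q) (suc i) = vertex q i
  vertex     ε       (suc ())

  vertex-∈ᵥ : ∀ {a b} (q : Walk a b) i → vertex q i ∈ᵥ q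
  vertex-∈ᵥ ε       zero    = refl
  vertex-∈ᵥ (_ ◅ q) zero    = inj₁ refl
  vertex-∈ᵥ (_ ◅ q) (suc i) = inj₂ (vertex-∈ᵥ q i)

  vertex-injective : ∀ {a b} (q : Walk a b) → Distinct q → Injective _≡_ _≡_ (vertex q)
  vertex-injective ε       _          {zero}  {zero}  _  = refl
  vertex-injective (_ ◅ q) _          {zero}  {zero}  _  = refl
  vertex-injective (_ ◅ q) (a∉q , _)  {zero}  {suc j} eq =
    contradiction (subst (_∈ᵥ q) (sym eq) (vertex-∈ᵥ q j)) a∉q
  vertex-injective (_ ◅ q) (a∉q , _)  {suc i} {zero}  eq =
    contradiction (subst (_∈ᵥ q) eq (vertex-∈ᵥ q i)) a∉q
  vertex-injective (_ ◅ q) (_ , dq)   {suc i} {suc j} eq = cong suc (vertex-injective q dq eq)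

  vertex-last : ∀ {a b} (q : Walk a b) → vertex q (fromℕ (steps q)) ≡ b
  vertex-last ε       = refl
  vertex-last (_ ◅ q) = vertex-last q

  -- The signs of the arcs of q, followed by the sign of a closing arc to t.
  closingSigns : ∀ {a b} (q : Walk a b) → Fin n → Fin (suc (steps q)) → Sign
  closingSigns {b = b} ε                 t zero    = σ b t
  closingSigns         (_◅_ {a} {c} _ q) t zero    = σ a c
  closingSigns         (_ ◅ q)           t (suc i) = closingSigns q t i

  closingSigns-last : ∀ {a b} (q : Walk a b) t → closingSigns q t (fromℕ (steps q)) ≡ σ b t
  closingSigns-last ε       t = refl
  closingSigns-last (_ ◅ q) t = closingSigns-last q t

  signProd-closingSigns : ∀ {a b} (q : Walk a b) t → signProd (closingSigns q t) ≡ σ a t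
  signProd-closingSigns {b = b} ε                 t = ·-identityʳ (σ b t)
  signProd-closingSigns         (_◅_ {a} {c} _ q) t = begin
    σ a c · signProd (closingSigns q t) ≡⟨ cong (σ a c ·_) (signProd-closingSigns q t) ⟩
    σ a c · σ c t                       ≡⟨ signOf-trans (lookup y a) (lookup y c) (lookup y t) ⟩
    σ a t                               ∎
    where open ≡-Reasoning

  arcAt : ∀ {a b} (q : Walk a b) t (i : Fin (steps q)) →
          Arc f (closingSigns q t (inject₁ i)) (vertex q (inject₁ i)) (vertex q (suc i))
  arcAt (e ◅ q) t zero    = e
  arcAt (e ◅ q) t (suc i) = arcAt q t i

  closing-cycle : ∀ {a b} (q : Walk a b) → Distinct q → Consistent b a →
                  Σ (Cycle f) λ c → sign c ≡ pos
  closing-cycle {a} q dq e =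
    record
      { len   = steps q
      ; vtx   = vertex q
      ; inj   = vertex-injective q dq
      ; sgn   = closingSigns q a
      ; arcs  = arcAt q a
      ; close = subst₂ (λ s u → Arc f s u a) (sym (closingSigns-last q a)) (sym (vertex-last q)) e
      }
    , trans (signProd-closingSigns q a) (signOf-refl (lookup y a))

module Weights {n} (f : BN n) (y : Config n) (F : Subset n) where
  open ConsistentWalks f y

  ind : Fin n → ℕ
  ind u = if does (u ∈? F) then 1 else 0

  +-ind-∈ : ∀ k {u} → u ∈ F → k + ind u ≡ suc k
  +-ind-∈ k {u} u∈F = begin
    k + ind u ≡⟨ cong (λ b → k + (if b then 1 else 0)) (dec-true (u ∈? F) u∈F) ⟩
    k + 1     ≡⟨ +-comm k 1 ⟩
    suc k     ∎
    where open ≡-Reasoning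

  -- The number of vertices of F on q, its endpoint excluded.
  weight : ∀ {a b} → Walk a b → ℕ
  weight ε             = 0
  weight (_◅_ {a} _ q) = ind a + weight q

  weight-snoc : ∀ {a u v} (q : Walk a u) (e : Consistent u v) →
                weight (q ◅◅ e ◅ ε) ≡ weight q + ind u
  weight-snoc {u = u} ε             e = +-identityʳ (ind u)
  weight-snoc         (_◅_ {a} _ q) e = trans (cong (ind a +_) (weight-snoc q e)) (sym (+-assoc (ind a) _ _))

  weight-bound : ∀ {a b} (H : Subset n) (q : Walk a b) → Distinct q →
                 (∀ {w} → w ∈ᵥ q → w ∈ F → w ∈ H) → weight q ≤ ∣ H ∣
  weight-bound H ε _ _ = z≤n
  weight-bound H (_◅_ {a} _ q) (a∉q , dq) F⊆H with a ∈? F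
  ... | no  _   = weight-bound H q dq (F⊆H ∘ inj₂)
  ... | yes a∈F =
    ≤-<-trans (weight-bound (H - a) q dq F⊆H-a) (x∈p⇒∣p-x∣<∣p∣ (F⊆H (inj₁ refl) a∈F))
    where
    F⊆H-a : ∀ {w} → w ∈ᵥ q → w ∈ F → w ∈ H - a
    F⊆H-a w∈q w∈F = x∈p∧x≢y⇒x∈p-y (F⊆H (inj₂ w∈q) w∈F) λ { refl → a∉q w∈q }

  record Reach (k : ℕ) (w : Fin n) : Set where
    constructor reach
    field
      {start}  : Fin n
      walk     : Walk start w
      distinct : Distinct walk
      heavy    : k ≤ weight walk

  reach-mono : ∀ {k k′ w} → k ≤ k′ → Reach k′ w → Reach k w
  reach-mono k≤k′ (reach q dq heavy) = reach q dq (≤-trans k≤k′ heavy)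

  ¬reach-beyond-F : ∀ {w} → ¬ Reach (suc ∣ F ∣) w
  ¬reach-beyond-F (reach q dq heavy) = 1+n≰n (≤-trans heavy (weight-bound F q dq λ _ w∈F → w∈F))

module Schedules {n} (f : BN n) (F : Subset n) where

  Ready : Pred (Fin n) 0ℓ → Fin n → Set
  Ready D v = ∀ u s → Arc f s u v → u ∉ F → D u

  Ready-mono : ∀ {D D′ v} → D ⊆ D′ → Ready D v → Ready D′ v
  Ready-mono D⊆D′ ready u s arc u∉F = D⊆D′ (ready u s arc u∉F)

  data Schedule (D : Pred (Fin n) 0ℓ) : List (Fin n) → Set where
    []  : Schedule D []
    _∷_ : ∀ {v vs} → Ready D v → Schedule (D ∪ ｛ v ｝) vs → Schedule D (v ∷ vs)

  Earlier : ∀ {m} → (Fin m → Fin n) → Fin m → Pred (Fin n) 0ℓ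
  Earlier g i u = ∃ λ j → j < i × g j ≡ u

  schedule-tabulate : ∀ {m D} (g : Fin m → Fin n) →
                      (∀ i → Ready (D ∪ Earlier g i) (g i)) → Schedule D (tabulate g)
  schedule-tabulate {zero}      g ready = []
  schedule-tabulate {suc m} {D} g ready =
    Ready-mono first (ready zero) ∷
    schedule-tabulate (g ∘ suc) (λ i → Ready-mono (shift i) (ready (suc i)))
    where
    first : D ∪ Earlier g zero ⊆ D
    first (inj₁ d) = d
    first (inj₂ (_ , () , _))
    shift : ∀ i → D ∪ Earlier g (suc i) ⊆ (D ∪ ｛ g zero ｝) ∪ Earlier (g ∘ suc) i
    shift i (inj₁ d)                 = inj₁ (inj₁ d)
    shift i (inj₂ (zero , _ , eq))   = inj₁ (inj₂ eq)
    shift i (inj₂ (suc j , lt , eq)) = inj₂ (j , s<s⁻¹ lt , eq)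

  permutation-schedule : (π : Permutation′ n) →
    (∀ i j → π ⟨$⟩ʳ i ∈ F → π ⟨$⟩ʳ j ∉ F → j < i) →
    (∀ i j s → π ⟨$⟩ʳ i ∉ F → π ⟨$⟩ʳ j ∉ F → Arc f s (π ⟨$⟩ʳ i) (π ⟨$⟩ʳ j) → i < j) →
    Schedule ∅ (tabulate (π ⟨$⟩ʳ_))
  permutation-schedule π F-last ordered = schedule-tabulate (π ⟨$⟩ʳ_) ready
    where
    ready : ∀ i → Ready (∅ ∪ Earlier (π ⟨$⟩ʳ_) i) (π ⟨$⟩ʳ i)
    ready i u s arc u∉F = inj₂ (π ⟨$⟩ˡ u , earlier , inverseʳ π)
      where
      πj∉F : π ⟨$⟩ʳ (π ⟨$⟩ˡ u) ∉ F
      πj∉F = subst (_∉ F) (sym (inverseʳ π)) u∉F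
      earlier : π ⟨$⟩ˡ u < i
      earlier with π ⟨$⟩ʳ i ∈? F
      ... | yes πi∈F = F-last i _ πi∈F πj∉F
      ... | no  πi∉F =
        ordered _ i s πj∉F πi∉F (subst (λ z → Arc f s z (π ⟨$⟩ʳ i)) (sym (inverseʳ π)) arc)

updateSeq-untouched : ∀ {n} (f : BN n) {w} us x → All (w ≢_) us →
                      lookup (updateSeq f us x) w ≡ lookup x w
updateSeq-untouched f []       x []          = refl
updateSeq-untouched f (u ∷ us) x (w≢u ∷ w∉us) =
  trans (updateSeq-untouched f us (update f u x) w∉us) (lookup∘update′ w≢u x _)

update-id : ∀ {n} (f : BN n) {u} x → lookup (f x) u ≡ lookup x u → update f u x ≡ x
update-id f {u} x fxu≡xu = trans (cong (x [ u ]≔_) fxu≡xu) ([]≔-lookup x u)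

updateSeq-fixed : ∀ {n} (f : BN n) {x} → f x ≡ x → ∀ us → updateSeq f us x ≡ x
updateSeq-fixed f         fx []       = refl
updateSeq-fixed f {x} fx (u ∷ us) =
  trans (cong (updateSeq f us) (update-id f x (cong (λ z → lookup z u) fx))) (updateSeq-fixed f fx us)

updateSeq-fixed⁻ : ∀ {n} (f : BN n) {x} us → Unique us → updateSeq f us x ≡ x →
                   All (λ u → lookup (f x) u ≡ lookup x u) us
updateSeq-fixed⁻ f         []       _              _     = []
updateSeq-fixed⁻ f {x} (u ∷ us) (u∉us ∷ unique) fixed =
  u-fixed ∷
  updateSeq-fixed⁻ f us unique (trans (cong (updateSeq f us) (sym (update-id f x u-fixed))) fixed)
  where
  open ≡-Reasoning
  u-fixed : lookup (f x) u ≡ lookup x u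
  u-fixed = begin
    lookup (f x) u                           ≡⟨ lookup∘update u x _ ⟨
    lookup (update f u x) u                  ≡⟨ updateSeq-untouched f us (update f u x) u∉us ⟨
    lookup (updateSeq f us (update f u x)) u ≡⟨ cong (λ z → lookup z u) fixed ⟩
    lookup x u                               ∎

seqUpdate-fixed⁻ : ∀ {n} (f : BN n) (π : Permutation′ n) {x} → seqUpdate f π x ≡ x → f x ≡ x
seqUpdate-fixed⁻ f π {x} fixed = Pointwise-≡⇒≡ (ext λ w →
  subst (λ v → lookup (f x) v ≡ lookup x v) (inverseʳ π) (tabulate⁻ all-fixed (π ⟨$⟩ˡ w)))
  where
  π-injective : ∀ {i j} → π ⟨$⟩ʳ i ≡ π ⟨$⟩ʳ j → i ≡ j
  π-injective eq = trans (sym (inverseˡ π)) (trans (cong (π ⟨$⟩ˡ_) eq) (inverseˡ π))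
  all-fixed : All (λ u → lookup (f x) u ≡ lookup x u) (tabulate (π ⟨$⟩ʳ_))
  all-fixed = updateSeq-fixed⁻ f _ (tabulate⁺ π-injective) fixed

module Convergence {n} (f : BN n) (y : Config n) (F : Subset n)
                   (fy : f y ≡ y) (noPositiveCycle : NoPositiveCycle f) where
  open ConsistentWalks f y
  open Weights f y F
  open Schedules f F

  extend : ∀ {k u v} → Reach k u → Consistent u v → Reach (k + ind u) v
  extend {k} {u} {v} (reach q dq heavy) e with v ∈ᵥ? q
  ... | yes v∈q = ⊥-elim (noPositiveCycle (closing-cycle (proj₁ loop) (proj₂ loop) e))
    where loop = suffix q v∈q dq
  ... | no  v∉q = reach (q ◅◅ e ◅ ε) (distinct-snoc q e dq v∉q)
                        (subst (k + ind u ≤_) (sym (weight-snoc q e)) (+-monoˡ-≤ (ind u) heavy))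

  -- D is the set of components already updated in the current round.
  Explained : ℕ → Pred (Fin n) 0ℓ → Config n → Set
  Explained p D x = ∀ w → lookup x w ≢ lookup y w → Reach p w × (D w → Reach (suc p) w)

  explained-⊆ : ∀ {p D D′} x → D′ ⊆ D → Explained p D x → Explained p D′ x
  explained-⊆ x D′⊆D explained w disagree with explained w disagree
  ... | r , rD = r , rD ∘ D′⊆D

  wrong-update⇒reach : ∀ {p D v} x → Ready D v → Explained p D x →
                       lookup (f x) v ≢ lookup y v → Reach (suc p) v
  wrong-update⇒reach {p} {v = v} x ready explained fxv≢yv
    with wrong-update⇒consistent-culprit fy x fxv≢yv
  ... | u , xu≢yu , e with explained u xu≢yu | u ∈? F
  ...   | r , _  | yes u∈F = subst (λ k → Reach k v) (+-ind-∈ p u∈F) (extend r e)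
  ...   | _ , rD | no  u∉F = reach-mono (m≤m+n (suc p) _) (extend (rD (ready u _ e u∉F)) e)

  step : ∀ {p D v} x → Ready D v → Explained p D x → Explained p (D ∪ ｛ v ｝) (update f v x)
  step {v = v} x ready explained w disagree with w ≟ v
  ... | no w≢v with explained w (disagree ∘ trans (lookup∘update′ w≢v x _))
  ...   | r , rD = r , [ rD , (λ v≡w → contradiction (sym v≡w) w≢v) ]
  step {v = v} x ready explained w disagree | yes refl =
    reach-mono (n≤1+n _) r , λ _ → r
    where
    r = wrong-update⇒reach x ready explained (disagree ∘ trans (lookup∘update v x _))

  sweep : ∀ {p D vs} x → Schedule D vs → Explained p D x →
          Explained p (D ∪ (_∈ₗ vs)) (updateSeq f vs x)
  sweep x [] explained = explained-⊆ x (λ { (inj₁ d) → d ; (inj₂ ()) }) explained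
  sweep {D = D} x (_∷_ {v} {vs} ready schedule) explained =
    explained-⊆ (updateSeq f vs (update f v x)) shift
                (sweep (update f v x) schedule (step x ready explained))
    where
    shift : D ∪ (_∈ₗ v ∷ vs) ⊆ (D ∪ ｛ v ｝) ∪ (_∈ₗ vs)
    shift (inj₁ d)            = inj₁ (inj₁ d)
    shift (inj₂ (here w≡v))   = inj₁ (inj₂ (sym w≡v))
    shift (inj₂ (there w∈vs)) = inj₂ w∈vs

  round : ∀ {p} (π : Permutation′ n) → Schedule ∅ (tabulate (π ⟨$⟩ʳ_)) →
          ∀ x → Explained p ∅ x → Explained (suc p) ∅ (seqUpdate f π x)
  round π schedule x explained w disagree =
    proj₂ (sweep x schedule explained w disagree) (inj₂ scheduled) , λ ()
    where
    scheduled : w ∈ₗ tabulate (π ⟨$⟩ʳ_)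
    scheduled = subst (_∈ₗ _) (inverseʳ π) (∈-tabulate⁺ (π ⟨$⟩ˡ w))

  converges : (π : Permutation′ n) → Schedule ∅ (tabulate (π ⟨$⟩ʳ_)) →
              ∀ x → iter (seqUpdate f π) (suc ∣ F ∣) x ≡ y
  converges π schedule x = Pointwise-≡⇒≡ (ext λ w →
    decidable-stable (_ ≟ᵇ _) (¬reach-beyond-F ∘ proj₁ ∘ explained (suc ∣ F ∣) w))
    where
    explained : ∀ k → Explained k ∅ (iter (seqUpdate f π) k x)
    explained zero    w _ = reach ε tt z≤n , λ ()
    explained (suc k)     = round π schedule _ (explained k)

iter-fixed : ∀ {A : Set} (g : A → A) k {z} → g z ≡ z → iter g k z ≡ z
iter-fixed g zero    gz≡z = refl
iter-fixed g (suc k) gz≡z = trans (cong g (iter-fixed g k gz≡z)) gz≡z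

iter-suc : ∀ {A : Set} (g : A → A) k x → iter g (suc k) x ≡ iter g k (g x)
iter-suc g zero    x = refl
iter-suc g (suc k) x = cong g (iter-suc g k x)

iter-constant⇒fixed : ∀ {A : Set} (g : A → A) k {y} → (∀ x → iter g k x ≡ y) → g y ≡ y
iter-constant⇒fixed g k {y} constant = begin
  g y                ≡⟨ cong g (constant y) ⟨
  iter g (suc k) y   ≡⟨ iter-suc g k y ⟩
  iter g k (g y)     ≡⟨ constant (g y) ⟩
  y                  ∎
  where open ≡-Reasoning

proposition4 : ∀ {n} (f : BN n) (F : Subset n) (π : Permutation′ n) (y : Config n)
    → NoPositiveCycle f
    → IsFVS f F
    → (∀ i j → π ⟨$⟩ʳ i ∈ F → π ⟨$⟩ʳ j ∉ F → j < i)
    → (∀ i j s → π ⟨$⟩ʳ i ∉ F → π ⟨$⟩ʳ j ∉ F → Arc f s (π ⟨$⟩ʳ i) (π ⟨$⟩ʳ j) → i < j)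
    → UniqueFixedPoint f y ⇔ (∀ x → iter (seqUpdate f π) (suc ∣ F ∣) x ≡ y)
proposition4 f F π y noPositiveCycle _ F-last ordered = mk⇔ converges fixed-unique
  where
  converges : UniqueFixedPoint f y → ∀ x → iter (seqUpdate f π) (suc ∣ F ∣) x ≡ y
  converges (fy , _) =
    Convergence.converges f y F fy noPositiveCycle π (Schedules.permutation-schedule f F π F-last ordered)
  fixed-unique : (∀ x → iter (seqUpdate f π) (suc ∣ F ∣) x ≡ y) → UniqueFixedPoint f y
  fixed-unique constant =
    seqUpdate-fixed⁻ f π (iter-constant⇒fixed (seqUpdate f π) (suc ∣ F ∣) constant) ,
    λ z fz → trans (sym (iter-fixed (seqUpdate f π) (suc ∣ F ∣) (updateSeq-fixed f fz (tabulate (π ⟨$⟩ʳ_)))))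
                   (constant z)
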